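{- Let $\alpha(k)$ be the largest odd divisor of $k$, $G(n)=\sum_{k=1}^n\frac{n+1-k}{k}\alpha(k)$, and $g(n)=\frac{n(n+2)}{3}-G(n)$ for $n\ge1$, $g(0)=0$. Then: (a) Let $m\ge1$ and let $n=2^m+\sum_{k=1}^{m-1}\varepsilon_k2^k$ with $\varepsilon_k\in\{0,1\}$ (an even integer with $2^m\le n<2^{m+1}$), and let $\tilde n=2^m+\sum_{k=1}^{m-1}(1-\varepsilon_k)2^k$. Then $g(n)=g(\tilde n)$. (b) More generally, for every positive integer $n$, if $\tilde n=3\cdot 2^{\lfloor\log_2 n\rfloor}-2-n$, then $g(n)=g(\tilde n)$.
   Context: $\alpha(k)$ is the largest odd divisor of the positive integer $k$; $\lfloor\cdot\rfloor$ is the floor function. -}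

module Defs where

open import Data.Nat using (ℕ; zero; suc; _+_; _*_; _∸_; _^_; _⊔_; _%_)
open import Data.Nat.Properties using (_≟_)
open import Data.Nat.Divisibility using (_∣_; _∣?_)
open import Data.Integer using (+_)
open import Data.Rational using (ℚ; 0ℚ; _/_) renaming (_+_ to _+ℚ_; _-_ to _-ℚ_)
open import Data.List using (List; upTo; filter; foldr)
open import Relation.Nullary.Decidable using (_×-dec_)

-- α(k): the largest odd divisor of k, i.e. the maximum of the odd d ≤ k with d ∣ k
-- (for k ≥ 1 the list is nonempty since 1 qualifies; α 0 = 0 is never used)
α : ℕ → ℕ
α k = foldr _⊔_ 0 (filter (λ d → (d % 2 ≟ 1) ×-dec (d ∣? k)) (upTo (suc k)))

Σ₁ℕ : ℕ → (ℕ → ℕ) → ℕ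
Σ₁ℕ zero    f = 0
Σ₁ℕ (suc n) f = Σ₁ℕ n f + f (suc n)

-- G(n) = Σ_{k=1}^{n} (n+1-k)/k · α(k)
-- term for k = suc i, so the denominator is nonzero
Gsum : ℕ → ℕ → ℚ
Gsum n zero    = 0ℚ
Gsum n (suc i) = Gsum n i +ℚ ((+ ((n + 1 ∸ suc i) * α (suc i))) / suc i)

G : ℕ → ℚ
G n = Gsum n n

g : ℕ → ℚ
g zero    = 0ℚ
g (suc n) = ((+ (suc n * (suc n + 2))) / 3) -ℚ G (suc n)

{-# OPTIONS --safe #-}
-- With H(m) = Σ_{k=1}^{m} α(k)/k one has G(n+1) = G(n) + H(n+1), so g is the sequence of
-- partial sums of D(m) = (2m+1)/3 − H(m).  Since α(2k) = α(k) and α(k) = k for odd k,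
-- H(2m) = H(m)/2 + m and H(2m+1) = H(m)/2 + m + 1, hence D(2m) = D(m)/2 + 1/6 and
-- D(2m+1) = D(m)/2 − 1/6.  Induction on L then gives D(j) + D(k) = 0 whenever j, k ≥ 2^L
-- and j + k + 1 = 3·2^L: the increments of g over the dyadic block [2^L, 2^(L+1)) are
-- antisymmetric about its centre, so g(2^L − 1 + t) = g(2^L − 1 + s) whenever t + s = 2^L.
-- Both parts are instances of this reflection, ñ being the mirror image of n in its block.
module Submission where

open import Defs

module _ where

  open import Data.Nat using (ℕ; zero; suc; _+_; _*_; _%_; _≤_; s≤s; NonZero)
  open import Data.Nat.Properties
    using (_≟_; ⊔-sel; m≤n⇒m≤n⊔o; m≤n⇒m≤o⊔n; ≤-refl; ≤-antisym; ≤-pred; ≤∧≢⇒<; *-comm; *-cancelˡ-≤;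
           m*n≢0; +-suc; even≢odd)
  open import Data.Nat.DivMod using ([m+kn]%n≡m%n)
  open import Data.Nat.Divisibility using (_∣_; _∣?_; ∣⇒≤; n∣m⇒m%n≡0; 1∣_; ∣-refl; ∣n⇒∣m*n)
  open import Data.Nat.Coprimality using (Coprime; coprime-divisor)
  open import Data.Nat.Primality using (irreducible[2])
  open import Data.List using (List; filter; upTo)
  open import Data.List.Properties using (foldr-preservesᵒ)
  open import Data.List.Membership.Propositional.Properties using (∈-filter⁺; ∈-filter⁻; ∈-upTo⁺; foldr-selective)
  open import Data.List.Relation.Unary.Any as Any using ()
  open import Data.List.Membership.Propositional using (_∈_)
  open import Data.Product using (_×_; _,_; proj₁; proj₂)
  open import Data.Sum using (inj₁; inj₂; [_,_])
  open import Relation.Nullary.Decidable using (Dec; _×-dec_)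
  open import Relation.Nullary.Negation using (contradiction)
  open import Relation.Binary.PropositionalEquality using (_≡_; refl; sym; trans; cong; subst)

  Odd : ℕ → Set
  Odd d = d % 2 ≡ 1

  odd⇒coprime-2 : ∀ {d} → Odd d → Coprime d 2
  odd⇒coprime-2 {d} odd (i∣d , i∣2) with irreducible[2] i∣2
  ... | inj₁ i≡1  = i≡1
  ... | inj₂ refl = contradiction (trans (sym (n∣m⇒m%n≡0 d 2 i∣d)) odd) λ ()

  odd-2*+1 : ∀ n → Odd (suc (2 * n))
  odd-2*+1 n = subst (λ m → suc m % 2 ≡ 1) (*-comm n 2) ([m+kn]%n≡m%n 1 n 2)

  module _ (k : ℕ) .{{_ : NonZero k}} where

    private
      oddDivisor? : (d : ℕ) → Dec (Odd d × d ∣ k)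
      oddDivisor? d = (d % 2 ≟ 1) ×-dec (d ∣? k)

      candidates : List ℕ
      candidates = filter oddDivisor? (upTo (suc k))

    α-greatest : ∀ {d} → Odd d → d ∣ k → d ≤ α k
    α-greatest {d} odd d∣k = foldr-preservesᵒ {P = d ≤_}
      (λ x y → [ m≤n⇒m≤n⊔o y , m≤n⇒m≤o⊔n x ]) 0 candidates
      (inj₂ (Any.map (λ { refl → ≤-refl }) d∈candidates))
      where
      d∈candidates : d ∈ candidates
      d∈candidates = ∈-filter⁺ oddDivisor? (∈-upTo⁺ (s≤s (∣⇒≤ d∣k))) (odd , d∣k)

    α-odd-divisor : Odd (α k) × α k ∣ k
    α-odd-divisor with foldr-selective ⊔-sel 0 candidates
    ... | inj₁ α≡0 = contradiction (subst (1 ≤_) α≡0 (α-greatest refl (1∣ k))) λ ()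
    ... | inj₂ α∈candidates = proj₂ (∈-filter⁻ oddDivisor? {xs = upTo (suc k)} α∈candidates)

    α-unique : ∀ {d} → Odd d → d ∣ k → (∀ {e} → Odd e → e ∣ k → e ≤ d) → α k ≡ d
    α-unique odd d∣k greatest =
      ≤-antisym (greatest (proj₁ α-odd-divisor) (proj₂ α-odd-divisor)) (α-greatest odd d∣k)

  α-odd : ∀ n → α (suc (2 * n)) ≡ suc (2 * n)
  α-odd n = α-unique (suc (2 * n)) (odd-2*+1 n) ∣-refl (λ _ → ∣⇒≤)

  α-double : ∀ n .{{_ : NonZero n}} → α (2 * n) ≡ α n
  α-double n = α-unique (2 * n) {{m*n≢0 2 n}} (proj₁ (α-odd-divisor n)) (∣n⇒∣m*n 2 (proj₂ (α-odd-divisor n)))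
    λ odd e∣2n → α-greatest n odd (coprime-divisor (odd⇒coprime-2 odd) e∣2n)

  data EvenOdd : ℕ → Set where
    even : ∀ n → EvenOdd (2 * n)
    odd  : ∀ n → EvenOdd (suc (2 * n))

  evenOdd : ∀ n → EvenOdd n
  evenOdd zero    = even 0
  evenOdd (suc n) with evenOdd n
  ... | even m = odd m
  ... | odd m  = subst EvenOdd (cong suc (+-suc m (m + 0))) (even (suc m))

  2*m≤1+2*n⇒m≤n : ∀ {m n} → 2 * m ≤ suc (2 * n) → m ≤ n
  2*m≤1+2*n⇒m≤n {m} {n} le = *-cancelˡ-≤ 2 (≤-pred (≤∧≢⇒< le (even≢odd m n)))

module _ where

  open import Data.Nat as ℕ using (ℕ; zero; suc; _∸_; _^_; _≤_; s≤s)
  import Data.Nat.Properties as ℕ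
  import Data.Nat.Tactic.RingSolver as ℕ-Solver
  open import Data.Integer as ℤ using (+_)
  import Data.Integer.Properties as ℤ
  open import Data.Rational using (ℚ; 0ℚ; 1ℚ; ½; _/_; _+_; _*_; _-_; toℚᵘ; fromℚᵘ)
  open import Data.Rational.Properties
    using (_≟_; toℚᵘ-injective; toℚᵘ-fromℚᵘ; toℚᵘ-homo-+; toℚᵘ-homo-*; fromℚᵘ-cong; /-cong; 0/n≡0;
           +-comm; +-identityʳ; +-0-group; +-*-commutativeRing)
  open import Data.Rational.Unnormalised as ℚᵘ using (mkℚᵘ; *≡*)
  import Data.Rational.Unnormalised.Properties as ℚᵘ
  open import Algebra.Properties.Group +-0-group using (∙-cancelʳ)
  open import Data.Maybe using (Maybe; just; nothing)
  open import Level using (0ℓ)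
  open import Relation.Nullary using (yes; no)
  open import Relation.Nullary.Negation using (contradiction)
  open import Relation.Binary.PropositionalEquality
  open import Tactic.RingSolver using (solve-∀)
  open import Tactic.RingSolver.Core.AlmostCommutativeRing using (AlmostCommutativeRing; fromCommutativeRing)

  fromℚᵘ-homo-+ : ∀ p q → fromℚᵘ (p ℚᵘ.+ q) ≡ fromℚᵘ p + fromℚᵘ q
  fromℚᵘ-homo-+ p q = toℚᵘ-injective (begin-equality
    toℚᵘ (fromℚᵘ (p ℚᵘ.+ q))                  ≃⟨ toℚᵘ-fromℚᵘ (p ℚᵘ.+ q) ⟩
    p ℚᵘ.+ q                                   ≃⟨ ℚᵘ.+-cong (toℚᵘ-fromℚᵘ p) (toℚᵘ-fromℚᵘ q) ⟨
    toℚᵘ (fromℚᵘ p) ℚᵘ.+ toℚᵘ (fromℚᵘ q)      ≃⟨ toℚᵘ-homo-+ (fromℚᵘ p) (fromℚᵘ q) ⟨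
    toℚᵘ (fromℚᵘ p + fromℚᵘ q)                ∎)
    where open ℚᵘ.≤-Reasoning

  fromℚᵘ-homo-* : ∀ p q → fromℚᵘ (p ℚᵘ.* q) ≡ fromℚᵘ p * fromℚᵘ q
  fromℚᵘ-homo-* p q = toℚᵘ-injective (begin-equality
    toℚᵘ (fromℚᵘ (p ℚᵘ.* q))                  ≃⟨ toℚᵘ-fromℚᵘ (p ℚᵘ.* q) ⟩
    p ℚᵘ.* q                                   ≃⟨ ℚᵘ.*-cong (toℚᵘ-fromℚᵘ p) (toℚᵘ-fromℚᵘ q) ⟨
    toℚᵘ (fromℚᵘ p) ℚᵘ.* toℚᵘ (fromℚᵘ q)      ≃⟨ toℚᵘ-homo-* (fromℚᵘ p) (fromℚᵘ q) ⟨
    toℚᵘ (fromℚᵘ p * fromℚᵘ q)                ∎)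
    where open ℚᵘ.≤-Reasoning

  /-+-/ : ∀ i j m n → i / suc m + j / suc n ≡ (i ℤ.* + suc n ℤ.+ j ℤ.* + suc m) / (suc m ℕ.* suc n)
  /-+-/ i j m n = sym (fromℚᵘ-homo-+ (mkℚᵘ i m) (mkℚᵘ j n))

  /-*-/ : ∀ i j m n → i / suc m * (j / suc n) ≡ (i ℤ.* j) / (suc m ℕ.* suc n)
  /-*-/ i j m n = sym (fromℚᵘ-homo-* (mkℚᵘ i m) (mkℚᵘ j n))

  n/n≡1 : ∀ n → + suc n / suc n ≡ 1ℚ
  n/n≡1 n = fromℚᵘ-cong {mkℚᵘ (+ suc n) n} {mkℚᵘ (+ 1) 0} (*≡* (trans (ℤ.*-identityʳ (+ suc n)) (sym (ℤ.*-identityˡ (+ suc n)))))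

  ι : ℕ → ℚ
  ι n = + n / 1

  ι-+ : ∀ m n → ι (m ℕ.+ n) ≡ ι m + ι n
  ι-+ m n = sym (trans (/-+-/ (+ m) (+ n) 0 0)
    (/-cong (trans (cong₂ ℤ._+_ (ℤ.*-identityʳ (+ m)) (ℤ.*-identityʳ (+ n))) (sym (ℤ.pos-+ m n))) refl))

  ι-suc : ∀ n → ι (suc n) ≡ 1ℚ + ι n
  ι-suc = ι-+ 1

  ι-double : ∀ n → ι (2 ℕ.* n) ≡ ι n + ι n
  ι-double n = trans (ι-+ n (n ℕ.+ 0)) (cong (λ m → ι n + ι m) (ℕ.+-identityʳ n))

  +[m*n]/d≡ιm*[n/d] : ∀ m n d → + (m ℕ.* n) / suc d ≡ ι m * (+ n / suc d)
  +[m*n]/d≡ιm*[n/d] m n d = sym (trans (/-*-/ (+ m) (+ n) 0 d) (/-cong (sym (ℤ.pos-* m n)) (ℕ.+-identityʳ (suc d))))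

  n/[2*d]≡½*[n/d] : ∀ i d → i / (2 ℕ.* suc d) ≡ ½ * (i / suc d)
  n/[2*d]≡½*[n/d] i d = sym (trans (/-*-/ (+ 1) i 1 d) (/-cong (ℤ.*-identityˡ i) refl))

  ℚ-ring : AlmostCommutativeRing 0ℓ 0ℓ
  ℚ-ring = fromCommutativeRing +-*-commutativeRing 0≟
    where
    0≟ : ∀ x → Maybe (0ℚ ≡ x)
    0≟ x with 0ℚ ≟ x
    ... | yes 0≡x = just 0≡x
    ... | no _    = nothing

  ⅓ ⅙ : ℚ
  ⅓ = + 1 / 3
  ⅙ = + 1 / 6

  H : ℕ → ℚ
  H zero    = 0ℚ
  H (suc k) = H k + + α (suc k) / suc k

  D : ℕ → ℚ
  D m = ι (suc (2 ℕ.* m)) * ⅓ - H m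

  Gsum-suc : ∀ n i → i ℕ.≤ suc n → Gsum (suc n) i ≡ Gsum n i + H i
  Gsum-suc n zero    _  = refl
  Gsum-suc n (suc i) si≤sn = begin
    Gsum (suc n) i + + ((suc n ℕ.+ 1 ∸ suc i) ℕ.* α (suc i)) / suc i
      ≡⟨ cong₂ _+_ (Gsum-suc n i (ℕ.m≤n⇒m≤1+n (ℕ.≤-pred si≤sn)))
                   (trans (cong (λ c → + (c ℕ.* α (suc i)) / suc i) count) (+[m*n]/d≡ιm*[n/d] (suc c) (α (suc i)) i)) ⟩
    (Gsum n i + H i) + ι (suc c) * r
      ≡⟨ cong (λ x → (Gsum n i + H i) + x * r) (ι-suc c) ⟩
    (Gsum n i + H i) + (1ℚ + ι c) * r
      ≡⟨ regroup (Gsum n i) (H i) (ι c) r ⟩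
    (Gsum n i + ι c * r) + (H i + r)
      ≡⟨ cong (λ x → (Gsum n i + x) + H (suc i)) (+[m*n]/d≡ιm*[n/d] c (α (suc i)) i) ⟨
    Gsum n (suc i) + H (suc i) ∎
    where
    open ≡-Reasoning
    c : ℕ
    c = n ℕ.+ 1 ∸ suc i
    r : ℚ
    r = + α (suc i) / suc i
    count : suc n ℕ.+ 1 ∸ suc i ≡ suc c
    count = ℕ.+-∸-assoc 1 (ℕ.≤-trans si≤sn (ℕ.≤-reflexive (ℕ.+-comm 1 n)))
    regroup : ∀ a b c r → (a + b) + (1ℚ + c) * r ≡ (a + c * r) + (b + r)
    regroup = solve-∀ ℚ-ring

  G-suc : ∀ n → G (suc n) ≡ G n + H (suc n)
  G-suc n = begin
    Gsum (suc n) (suc n)                              ≡⟨ Gsum-suc n (suc n) ℕ.≤-refl ⟩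
    Gsum n (suc n) + H (suc n)                        ≡⟨ cong (λ x → (G n + x) + H (suc n)) lastTerm ⟩
    (G n + 0ℚ) + H (suc n)                            ≡⟨ cong (_+ H (suc n)) (+-identityʳ (G n)) ⟩
    G n + H (suc n)                                   ∎
    where
    open ≡-Reasoning
    lastTerm : + ((n ℕ.+ 1 ∸ suc n) ℕ.* α (suc n)) / suc n ≡ 0ℚ
    lastTerm = trans (cong (λ c → + (c ℕ.* α (suc n)) / suc n)
                           (trans (cong (_∸ suc n) (ℕ.+-comm n 1)) (ℕ.n∸n≡0 n)))
                     (0/n≡0 (suc n))

  g-formula : ∀ n → g n ≡ ι (n ℕ.* (n ℕ.+ 2)) * ⅓ - G n
  g-formula zero    = refl
  g-formula (suc n) = cong (_- G (suc n))
    (trans (cong (λ x → + x / 3) (sym (ℕ.*-identityʳ m))) (+[m*n]/d≡ιm*[n/d] m 1 2))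
    where
    m : ℕ
    m = suc n ℕ.* (suc n ℕ.+ 2)

  g-suc : ∀ n → g (suc n) ≡ g n + D (suc n)
  g-suc n = begin
    g (suc n)
      ≡⟨ g-formula (suc n) ⟩
    ι (suc n ℕ.* (suc n ℕ.+ 2)) * ⅓ - G (suc n)
      ≡⟨ cong₂ (λ x y → x * ⅓ - y) (trans (cong ι (numerator n)) (ι-+ (n ℕ.* (n ℕ.+ 2)) (suc (2 ℕ.* suc n)))) (G-suc n) ⟩
    (ι (n ℕ.* (n ℕ.+ 2)) + ι (suc (2 ℕ.* suc n))) * ⅓ - (G n + H (suc n))
      ≡⟨ regroup (ι (n ℕ.* (n ℕ.+ 2))) (ι (suc (2 ℕ.* suc n))) (G n) (H (suc n)) ⟩
    (ι (n ℕ.* (n ℕ.+ 2)) * ⅓ - G n) + D (suc n)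
      ≡⟨ cong (_+ D (suc n)) (g-formula n) ⟨
    g n + D (suc n) ∎
    where
    open ≡-Reasoning
    numerator : ∀ n → suc n ℕ.* (suc n ℕ.+ 2) ≡ n ℕ.* (n ℕ.+ 2) ℕ.+ suc (2 ℕ.* suc n)
    numerator = ℕ-Solver.solve-∀
    regroup : ∀ a b c d → (a + b) * ⅓ - (c + d) ≡ (a * ⅓ - c) + (b * ⅓ - d)
    regroup = solve-∀ ℚ-ring

  H-double   : ∀ n → H (2 ℕ.* n) ≡ ½ * H n + ι n
  H-double+1 : ∀ n → H (suc (2 ℕ.* n)) ≡ ½ * H n + ι (suc n)

  H-double zero    = refl
  H-double (suc n) = begin
    H (n ℕ.+ suc (n ℕ.+ 0)) + + α (2 ℕ.* suc n) / (2 ℕ.* suc n)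
      ≡⟨ cong₂ _+_ (trans (cong H (ℕ.+-suc n (n ℕ.+ 0))) (H-double+1 n))
                   (trans (cong (λ a → + a / (2 ℕ.* suc n)) (α-double (suc n))) (n/[2*d]≡½*[n/d] (+ α (suc n)) n)) ⟩
    (½ * H n + ι (suc n)) + ½ * r
      ≡⟨ regroup (H n) (ι (suc n)) r ⟩
    ½ * (H n + r) + ι (suc n) ∎
    where
    open ≡-Reasoning
    r : ℚ
    r = + α (suc n) / suc n
    regroup : ∀ h x r → (½ * h + x) + ½ * r ≡ ½ * (h + r) + x
    regroup = solve-∀ ℚ-ring

  H-double+1 n = begin
    H (2 ℕ.* n) + + α (suc (2 ℕ.* n)) / suc (2 ℕ.* n)
      ≡⟨ cong₂ _+_ (H-double n) (trans (cong (λ a → + a / suc (2 ℕ.* n)) (α-odd n)) (n/n≡1 (2 ℕ.* n))) ⟩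
    (½ * H n + ι n) + 1ℚ
      ≡⟨ regroup (H n) (ι n) ⟩
    ½ * H n + (1ℚ + ι n)
      ≡⟨ cong (λ y → ½ * H n + y) (ι-suc n) ⟨
    ½ * H n + ι (suc n) ∎
    where
    open ≡-Reasoning
    regroup : ∀ h x → (½ * h + x) + 1ℚ ≡ ½ * h + (1ℚ + x)
    regroup = solve-∀ ℚ-ring

  ι-2*+1 : ∀ n → ι (suc (2 ℕ.* n)) ≡ 1ℚ + (ι n + ι n)
  ι-2*+1 n = trans (ι-suc (2 ℕ.* n)) (cong (λ y → 1ℚ + y) (ι-double n))

  D-double : ∀ n → D (2 ℕ.* n) ≡ ½ * D n + ⅙
  D-double n = begin
    ι (suc (2 ℕ.* (2 ℕ.* n))) * ⅓ - H (2 ℕ.* n)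
      ≡⟨ cong₂ (λ y h → y * ⅓ - h) (trans (ι-2*+1 (2 ℕ.* n)) (cong (λ y → 1ℚ + (y + y)) (ι-double n))) (H-double n) ⟩
    (1ℚ + ((x + x) + (x + x))) * ⅓ - (½ * H n + x)
      ≡⟨ regroup x (H n) ⟩
    ½ * ((1ℚ + (x + x)) * ⅓ - H n) + ⅙
      ≡⟨ cong (λ y → ½ * (y * ⅓ - H n) + ⅙) (ι-2*+1 n) ⟨
    ½ * D n + ⅙ ∎
    where
    open ≡-Reasoning
    x : ℚ
    x = ι n
    regroup : ∀ x h → (1ℚ + ((x + x) + (x + x))) * ⅓ - (½ * h + x) ≡ ½ * ((1ℚ + (x + x)) * ⅓ - h) + ⅙
    regroup = solve-∀ ℚ-ring

  D-double+1 : ∀ n → D (suc (2 ℕ.* n)) ≡ ½ * D n - ⅙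
  D-double+1 n = begin
    ι (suc (2 ℕ.* suc (2 ℕ.* n))) * ⅓ - H (suc (2 ℕ.* n))
      ≡⟨ cong₂ (λ y h → y * ⅓ - h) (trans (ι-2*+1 (suc (2 ℕ.* n))) (cong (λ y → 1ℚ + (y + y)) (ι-2*+1 n)))
                                   (trans (H-double+1 n) (cong (λ y → ½ * H n + y) (ι-suc n))) ⟩
    (1ℚ + ((1ℚ + (x + x)) + (1ℚ + (x + x)))) * ⅓ - (½ * H n + (1ℚ + x))
      ≡⟨ regroup x (H n) ⟩
    ½ * ((1ℚ + (x + x)) * ⅓ - H n) - ⅙
      ≡⟨ cong (λ y → ½ * (y * ⅓ - H n) - ⅙) (ι-2*+1 n) ⟨
    ½ * D n - ⅙ ∎
    where
    open ≡-Reasoning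
    x : ℚ
    x = ι n
    regroup : ∀ x h → (1ℚ + ((1ℚ + (x + x)) + (1ℚ + (x + x)))) * ⅓ - (½ * h + (1ℚ + x))
                      ≡ ½ * ((1ℚ + (x + x)) * ⅓ - h) - ⅙
    regroup = solve-∀ ℚ-ring

  D-antisymmetric : ∀ L {j k} → 2 ^ L ≤ j → 2 ^ L ≤ k → suc (j ℕ.+ k) ≡ 3 ℕ.* 2 ^ L → D j + D k ≡ 0ℚ
  D-antisymmetric zero {zero}        ()  _  _
  D-antisymmetric zero {suc _}       {zero} _ () _
  D-antisymmetric zero {1}           {1} _ _ _ = refl
  D-antisymmetric zero {1}           {suc (suc _)} _ _ ()
  D-antisymmetric zero {suc (suc j)} {suc k} _ _ eq =
    contradiction (ℕ.suc-injective (ℕ.suc-injective (ℕ.suc-injective eq))) (ℕ.m+1+n≢0 j)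
  D-antisymmetric (suc L) {j} {k} = byParity (evenOdd j) (evenOdd k)
    where
    3*[2*x]≡2*[3*x] : ∀ x → 3 ℕ.* (2 ℕ.* x) ≡ 2 ℕ.* (3 ℕ.* x)
    3*[2*x]≡2*[3*x] = ℕ-Solver.solve-∀
    sum-even-odd : ∀ a b → suc (2 ℕ.* a ℕ.+ suc (2 ℕ.* b)) ≡ 2 ℕ.* suc (a ℕ.+ b)
    sum-even-odd = ℕ-Solver.solve-∀
    sum-odd-odd : ∀ a b → suc (suc (2 ℕ.* a) ℕ.+ suc (2 ℕ.* b)) ≡ suc (2 ℕ.* suc (a ℕ.+ b))
    sum-odd-odd = ℕ-Solver.solve-∀
    regroup : ∀ x y → (½ * x + ⅙) + (½ * y - ⅙) ≡ ½ * (x + y)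
    regroup = solve-∀ ℚ-ring

    even+odd : ∀ {a b} → 2 ^ suc L ≤ 2 ℕ.* a → 2 ^ suc L ≤ suc (2 ℕ.* b) →
               suc (2 ℕ.* a ℕ.+ suc (2 ℕ.* b)) ≡ 3 ℕ.* 2 ^ suc L → D (2 ℕ.* a) + D (suc (2 ℕ.* b)) ≡ 0ℚ
    even+odd {a} {b} la lb eq = begin
      D (2 ℕ.* a) + D (suc (2 ℕ.* b))  ≡⟨ cong₂ _+_ (D-double a) (D-double+1 b) ⟩
      (½ * D a + ⅙) + (½ * D b - ⅙)    ≡⟨ regroup (D a) (D b) ⟩
      ½ * (D a + D b)                  ≡⟨ cong (½ *_) (D-antisymmetric L {a} {b} (ℕ.*-cancelˡ-≤ 2 la) (2*m≤1+2*n⇒m≤n lb) halved) ⟩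
      ½ * 0ℚ                           ≡⟨⟩
      0ℚ                               ∎
      where
      open ≡-Reasoning
      halved : suc (a ℕ.+ b) ≡ 3 ℕ.* 2 ^ L
      halved = ℕ.*-cancelˡ-≡ _ _ 2 (trans (sym (sum-even-odd a b)) (trans eq (3*[2*x]≡2*[3*x] (2 ^ L))))

    -- j + k + 1 = 3 · 2^(L+1) is even, so exactly one of j, k is odd.
    byParity : ∀ {j k} → EvenOdd j → EvenOdd k →
               2 ^ suc L ≤ j → 2 ^ suc L ≤ k → suc (j ℕ.+ k) ≡ 3 ℕ.* 2 ^ suc L → D j + D k ≡ 0ℚ
    byParity (even a) (odd b)  lj lk eq = even+odd {a} {b} lj lk eq
    byParity (odd a)  (even b) lj lk eq = trans (+-comm (D (suc (2 ℕ.* a))) (D (2 ℕ.* b)))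
      (even+odd {b} {a} lk lj (trans (cong suc (ℕ.+-comm (2 ℕ.* b) (suc (2 ℕ.* a)))) eq))
    byParity (even a) (even b) _ _ eq = contradiction
      (trans (sym (3*[2*x]≡2*[3*x] (2 ^ L))) (trans (sym eq) (cong suc (sym (ℕ.*-distribˡ-+ 2 a b)))))
      (ℕ.even≢odd (3 ℕ.* 2 ^ L) (a ℕ.+ b))
    byParity (odd a)  (odd b)  _ _ eq = contradiction
      (trans (sym (3*[2*x]≡2*[3*x] (2 ^ L))) (trans (sym eq) (sum-odd-odd a b)))
      (ℕ.even≢odd (3 ℕ.* 2 ^ L) (suc (a ℕ.+ b)))

  x+x≡y+y⇒x≡y : ∀ {x y} → x + x ≡ y + y → x ≡ y
  x+x≡y+y⇒x≡y {x} {y} eq = begin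
    x            ≡⟨ half-double x ⟩
    ½ * (x + x)  ≡⟨ cong (½ *_) eq ⟩
    ½ * (y + y)  ≡⟨ half-double y ⟨
    y            ∎
    where
    open ≡-Reasoning
    half-double : ∀ x → x ≡ ½ * (x + x)
    half-double = solve-∀ ℚ-ring

  partialSums-reflect : (f d : ℕ → ℚ) → (∀ n → f (suc n) ≡ f n + d (suc n)) →
    ∀ {p N} → (∀ a b → suc (a ℕ.+ b) ≡ N → d (suc (p ℕ.+ a)) + d (suc (p ℕ.+ b)) ≡ 0ℚ) →
    ∀ {t s} → t ℕ.+ s ≡ N → f (p ℕ.+ t) ≡ f (p ℕ.+ s)
  partialSums-reflect f d f-suc {p} {N} paired {t} {s} t+s≡N = ∙-cancelʳ (f p) _ _ (begin
    f (p ℕ.+ t) + f p          ≡⟨ cong (λ y → f (p ℕ.+ t) + y) block ⟨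
    f (p ℕ.+ t) + f (p ℕ.+ N)  ≡⟨ exchange t s t+s≡N ⟩
    f (p ℕ.+ s) + f p          ∎)
    where
    open ≡-Reasoning
    f-suc′ : ∀ a → f (p ℕ.+ suc a) ≡ f (p ℕ.+ a) + d (suc (p ℕ.+ a))
    f-suc′ a = trans (cong f (ℕ.+-suc p a)) (f-suc (p ℕ.+ a))
    regroup₁ : ∀ x y z → (x + y) + z ≡ (x + z) + y
    regroup₁ = solve-∀ ℚ-ring
    regroup₂ : ∀ x y z w → ((x + y) + z) + w ≡ (x + z) + (w + y)
    regroup₂ = solve-∀ ℚ-ring
    exchange : ∀ t s → t ℕ.+ s ≡ N → f (p ℕ.+ t) + f (p ℕ.+ N) ≡ f (p ℕ.+ s) + f p
    exchange zero    s refl = trans (+-comm (f (p ℕ.+ 0)) (f (p ℕ.+ s))) (cong (λ q → f (p ℕ.+ s) + f q) (ℕ.+-identityʳ p))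
    exchange (suc t) s e = begin
      f (p ℕ.+ suc t) + f (p ℕ.+ N)
        ≡⟨ cong (_+ f (p ℕ.+ N)) (f-suc′ t) ⟩
      (f (p ℕ.+ t) + d (suc (p ℕ.+ t))) + f (p ℕ.+ N)
        ≡⟨ regroup₁ (f (p ℕ.+ t)) (d (suc (p ℕ.+ t))) (f (p ℕ.+ N)) ⟩
      (f (p ℕ.+ t) + f (p ℕ.+ N)) + d (suc (p ℕ.+ t))
        ≡⟨ cong (_+ d (suc (p ℕ.+ t))) (exchange t (suc s) (trans (ℕ.+-suc t s) e)) ⟩
      (f (p ℕ.+ suc s) + f p) + d (suc (p ℕ.+ t))
        ≡⟨ cong (λ y → (y + f p) + d (suc (p ℕ.+ t))) (f-suc′ s) ⟩
      ((f (p ℕ.+ s) + d (suc (p ℕ.+ s))) + f p) + d (suc (p ℕ.+ t))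
        ≡⟨ regroup₂ (f (p ℕ.+ s)) (d (suc (p ℕ.+ s))) (f p) (d (suc (p ℕ.+ t))) ⟩
      (f (p ℕ.+ s) + f p) + (d (suc (p ℕ.+ t)) + d (suc (p ℕ.+ s)))
        ≡⟨ cong (λ y → (f (p ℕ.+ s) + f p) + y) (paired t s e) ⟩
      (f (p ℕ.+ s) + f p) + 0ℚ
        ≡⟨ +-identityʳ _ ⟩
      f (p ℕ.+ s) + f p ∎
    block : f (p ℕ.+ N) ≡ f p
    block = x+x≡y+y⇒x≡y (trans (exchange N 0 (ℕ.+-identityʳ N)) (cong (λ q → f q + f p) (ℕ.+-identityʳ p)))

  block-pair-sum : ∀ {X p a b} → suc p ≡ X → suc (a ℕ.+ b) ≡ X → suc (suc (p ℕ.+ a) ℕ.+ suc (p ℕ.+ b)) ≡ 3 ℕ.* X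
  block-pair-sum {a = a} {b} refl refl = identity a b
    where
    identity : ∀ a b → suc (suc (a ℕ.+ b ℕ.+ a) ℕ.+ suc (a ℕ.+ b ℕ.+ b)) ≡ 3 ℕ.* suc (a ℕ.+ b)
    identity = ℕ-Solver.solve-∀

  g-reflect : ∀ L {p t s} → suc p ≡ 2 ^ L → t ℕ.+ s ≡ 2 ^ L → g (p ℕ.+ t) ≡ g (p ℕ.+ s)
  g-reflect L {p} 1+p≡2^L = partialSums-reflect g D g-suc {p} λ a b 1+a+b≡2^L →
    D-antisymmetric L {suc (p ℕ.+ a)} {suc (p ℕ.+ b)} (above a) (above b) (block-pair-sum 1+p≡2^L 1+a+b≡2^L)
    where
    above : ∀ a → 2 ^ L ≤ suc (p ℕ.+ a)
    above a = subst (_≤ suc (p ℕ.+ a)) 1+p≡2^L (s≤s (ℕ.m≤m+n p a))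

open import Data.Nat using (ℕ; zero; suc; _+_; _*_; _∸_; _^_; _≥_; _≤_; _<_; _≤?_; NonZero; ⌊_/2⌋; >-nonZero; >-nonZero⁻¹)
open import Data.Nat.Properties
  using (+-suc; +-assoc; +-identityʳ; ≤-trans; ≤-reflexive; +-monoʳ-≤; *-monoʳ-≤; ⌊n/2⌋≤⌈n/2⌉; ⌊n/2⌋+⌈n/2⌉≡n;
         ≰⇒>; 1+n≰n; m+n∸m≡n; +-cancelˡ-<; m≤n⇒∃[o]m+o≡n)
open import Data.Nat.Logarithm using (⌊log₂_⌋; ⌊log₂⌋-mono-≤; ⌊log₂⌊n/2⌋⌋≡⌊log₂n⌋∸1; ⌊log₂[2^n]⌋≡n)
import Data.Nat.Tactic.RingSolver as ℕ-Solver
open import Data.Bool using (Bool; true; false; if_then_else_)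
open import Data.Product using (_×_; _,_)
open import Relation.Nullary using (yes; no)
open import Relation.Nullary.Negation using (contradiction)
open import Relation.Binary.PropositionalEquality

Σ₁ℕ-cong : ∀ n {f h : ℕ → ℕ} → (∀ k → f k ≡ h k) → Σ₁ℕ n f ≡ Σ₁ℕ n h
Σ₁ℕ-cong zero    f≗h = refl
Σ₁ℕ-cong (suc n) f≗h = cong₂ _+_ (Σ₁ℕ-cong n f≗h) (f≗h (suc n))

Σ₁ℕ-distrib-+ : ∀ n (f h : ℕ → ℕ) → Σ₁ℕ n f + Σ₁ℕ n h ≡ Σ₁ℕ n (λ k → f k + h k)
Σ₁ℕ-distrib-+ zero    f h = refl
Σ₁ℕ-distrib-+ (suc n) f h =
  trans (+-+-interchange (Σ₁ℕ n f) (f (suc n)) (Σ₁ℕ n h) (h (suc n)))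
        (cong (_+ (f (suc n) + h (suc n))) (Σ₁ℕ-distrib-+ n f h))
  where
  +-+-interchange : ∀ a b c d → (a + b) + (c + d) ≡ (a + c) + (b + d)
  +-+-interchange = ℕ-Solver.solve-∀

2+Σ₁ℕ2^≡2^[1+n] : ∀ n → 2 + Σ₁ℕ n (2 ^_) ≡ 2 ^ suc n
2+Σ₁ℕ2^≡2^[1+n] zero    = refl
2+Σ₁ℕ2^≡2^[1+n] (suc n) = begin
  2 + (Σ₁ℕ n (2 ^_) + 2 ^ suc n)   ≡⟨ +-assoc 2 (Σ₁ℕ n (2 ^_)) (2 ^ suc n) ⟨
  2 + Σ₁ℕ n (2 ^_) + 2 ^ suc n     ≡⟨ cong (_+ 2 ^ suc n) (2+Σ₁ℕ2^≡2^[1+n] n) ⟩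
  2 ^ suc n + 2 ^ suc n            ≡⟨ cong (2 ^ suc n +_) (+-identityʳ (2 ^ suc n)) ⟨
  2 ^ suc (suc n)                  ∎
  where open ≡-Reasoning

select-complement : ∀ b x → (if b then x else 0) + (if b then 0 else x) ≡ x
select-complement true  x = +-identityʳ x
select-complement false x = refl

digits+complement : ∀ (ε : ℕ → Bool) n →
  2 + (Σ₁ℕ n (λ k → if ε k then 2 ^ k else 0) + Σ₁ℕ n (λ k → if ε k then 0 else 2 ^ k)) ≡ 2 ^ suc n
digits+complement ε n = trans
  (cong (2 +_) (trans (Σ₁ℕ-distrib-+ n _ _) (Σ₁ℕ-cong n λ k → select-complement (ε k) (2 ^ k))))
  (2+Σ₁ℕ2^≡2^[1+n] n)

2*⌊n/2⌋≤n : ∀ n → 2 * ⌊ n /2⌋ ≤ n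
2*⌊n/2⌋≤n n = ≤-trans
  (+-monoʳ-≤ ⌊ n /2⌋ (≤-trans (≤-reflexive (+-identityʳ ⌊ n /2⌋)) (⌊n/2⌋≤⌈n/2⌉ n)))
  (≤-reflexive (⌊n/2⌋+⌈n/2⌉≡n n))

2^⌊log₂n⌋≤n : ∀ n .{{_ : NonZero n}} → 2 ^ ⌊log₂ n ⌋ ≤ n
2^⌊log₂n⌋≤n n = bound _ n refl
  where
  bound : ∀ k n .{{_ : NonZero n}} → ⌊log₂ n ⌋ ≡ k → 2 ^ k ≤ n
  bound zero    n             _    = >-nonZero⁻¹ n
  bound (suc k) 1             ()
  bound (suc k) (suc (suc m)) log≡ = ≤-trans
    (*-monoʳ-≤ 2 (bound k ⌊ suc (suc m) /2⌋ (trans (⌊log₂⌊n/2⌋⌋≡⌊log₂n⌋∸1 (suc (suc m))) (cong (_∸ 1) log≡))))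
    (2*⌊n/2⌋≤n (suc (suc m)))

n<2^[1+⌊log₂n⌋] : ∀ n → n < 2 ^ suc ⌊log₂ n ⌋
n<2^[1+⌊log₂n⌋] n with 2 ^ suc ⌊log₂ n ⌋ ≤? n
... | no  2^[1+k]≰n = ≰⇒> 2^[1+k]≰n
... | yes 2^[1+k]≤n = contradiction
  (subst (_≤ ⌊log₂ n ⌋) (⌊log₂[2^n]⌋≡n (suc ⌊log₂ n ⌋)) (⌊log₂⌋-mono-≤ 2^[1+k]≤n)) 1+n≰n

1+p≡X⇒p+[1+a]≡X+a : ∀ {p X} a → suc p ≡ X → p + suc a ≡ X + a
1+p≡X⇒p+[1+a]≡X+a {p} a 1+p≡X = trans (+-suc p a) (cong (_+ a) 1+p≡X)

reflection-formula : ∀ {X n} a b → suc (a + b) ≡ X → X + a ≡ n → 3 * X ∸ 2 ∸ n ≡ a + b + b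
reflection-formula a b refl refl = begin
  3 * suc (a + b) ∸ 2 ∸ (suc (a + b) + a)                     ≡⟨ cong (λ x → x ∸ 2 ∸ (suc (a + b) + a)) (expand a b) ⟩
  2 + ((suc (a + b) + a) + (a + b + b)) ∸ 2 ∸ (suc (a + b) + a) ≡⟨ m+n∸m≡n (suc (a + b) + a) (a + b + b) ⟩
  a + b + b                                                    ∎
  where
  open ≡-Reasoning
  expand : ∀ a b → 3 * suc (a + b) ≡ 2 + ((suc (a + b) + a) + (a + b + b))
  expand = ℕ-Solver.solve-∀

binary-complement : ∀ q (ε : ℕ → Bool) →
  g (2 ^ suc q + Σ₁ℕ q (λ k → if ε k then 2 ^ k else 0)) ≡ g (2 ^ suc q + Σ₁ℕ q (λ k → if ε k then 0 else 2 ^ k))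
binary-complement q ε = begin
  g (2 ^ suc q + S)         ≡⟨ cong g (1+p≡X⇒p+[1+a]≡X+a S 1+p≡2^m) ⟨
  g (suc (S + S̃) + suc S)   ≡⟨ g-reflect (suc q) 1+p≡2^m (trans (cong suc (+-suc S S̃)) 1+p≡2^m) ⟩
  g (suc (S + S̃) + suc S̃)   ≡⟨ cong g (1+p≡X⇒p+[1+a]≡X+a S̃ 1+p≡2^m) ⟩
  g (2 ^ suc q + S̃)         ∎
  where
  open ≡-Reasoning
  S S̃ : ℕ
  S = Σ₁ℕ q (λ k → if ε k then 2 ^ k else 0)
  S̃ = Σ₁ℕ q (λ k → if ε k then 0 else 2 ^ k)
  1+p≡2^m : suc (suc (S + S̃)) ≡ 2 ^ suc q
  1+p≡2^m = digits+complement ε q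

m+n<2*m⇒n<m : ∀ m n → m + n < 2 * m → n < m
m+n<2*m⇒n<m m n lt = subst (n <_) (+-identityʳ m) (+-cancelˡ-< m n (m + 0) lt)

block-reflection : ∀ L {n} → 2 ^ L ≤ n → n < 2 ^ suc L → g n ≡ g (3 * 2 ^ L ∸ 2 ∸ n)
block-reflection L {n} 2^L≤n n<2^[1+L] with m≤n⇒∃[o]m+o≡n 2^L≤n
... | a , X+a≡n with m≤n⇒∃[o]m+o≡n (m+n<2*m⇒n<m (2 ^ L) a (subst (_< 2 ^ suc L) (sym X+a≡n) n<2^[1+L]))
... | b , 1+a+b≡X = begin
  g n                    ≡⟨ cong g (trans (1+p≡X⇒p+[1+a]≡X+a a 1+a+b≡X) X+a≡n) ⟨
  g (a + b + suc a)      ≡⟨ g-reflect L 1+a+b≡X 1+a+b≡X ⟩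
  g (a + b + b)          ≡⟨ cong g (reflection-formula a b 1+a+b≡X X+a≡n) ⟨
  g (3 * 2 ^ L ∸ 2 ∸ n)  ∎
  where open ≡-Reasoning

proposition6 :
    ((m : ℕ) → m ≥ 1 → (ε : ℕ → Bool) →
      g (2 ^ m + Σ₁ℕ (m ∸ 1) (λ k → if ε k then 2 ^ k else 0))
        ≡ g (2 ^ m + Σ₁ℕ (m ∸ 1) (λ k → if ε k then 0 else 2 ^ k)))
    × ((n : ℕ) → n ≥ 1 → g n ≡ g (3 * 2 ^ ⌊log₂ n ⌋ ∸ 2 ∸ n))
proposition6 =
  (λ { (suc q) _ ε → binary-complement q ε }) ,
  (λ n n≥1 → block-reflection ⌊log₂ n ⌋ (2^⌊log₂n⌋≤n n {{>-nonZero n≥1}}) (n<2^[1+⌊log₂n⌋] n))
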